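{- The Goldner–Harary graph is a Random Apollonian Network whose clique-tree is a $4$-regular tree (and it has at least $6$ vertices).
   Context: The Goldner–Harary graph is the $11$-vertex maximal planar graph obtained from the triangular bipyramid ($K_5$ minus an edge, drawn in the plane) by inserting a new vertex into each of its six triangular faces and joining it to the three vertices of that face. A Random Apollonian Network (RAN) is a graph obtained by starting from a triangle embedded in the plane and repeatedly choosing a bounded triangular face of the current plane graph, inserting a new vertex inside it and joining it to the three vertices of that face; each RAN has a unique clique-tree. For a chordal graph, the clique-intersection graph has the maximal cliques as vertices, with an edge between two intersecting maximal cliques weighted by the size of their intersection; a clique-tree is a maximum-weight spanning tree of it. A tree is $4$-regular if every non-leaf vertex has degree $4$. (The paper calls the class of RANs on at least $6$ vertices with $4$-regular clique-tree $C_1$, and states the result as "the Goldner–Harary graph belongs to $C_1$".) -}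

module Defs where

open import Data.Nat using (ℕ; zero; suc; _+_; _≤_; _<_)
open import Data.Bool using (Bool; true; false; _∨_; _∧_; if_then_else_)
open import Data.Fin using (Fin; zero; suc; toℕ; inject₁; fromℕ; _≟_)
open import Data.Fin.Subset using (Subset; _∈_; _⊆_; _∩_; ∣_∣)
open import Data.List using (List; []; _∷_)
open import Data.Bool.ListAction using (any)
open import Data.List.Membership.Propositional using () renaming (_∈_ to _∈ₗ_)
open import Data.List.Relation.Unary.Any using (_─_)
open import Data.Product using (Σ; _×_; _,_; ∃)
open import Relation.Nullary using (¬_)
open import Relation.Nullary.Decidable using (⌊_⌋)
open import Relation.Binary.PropositionalEquality using (_≡_; _≢_)
open import Function.Bundles using (_↔_; Inverse)

Graph : ℕ → Set
Graph n = Fin n → Fin n → Bool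

sumFin : ∀ {k} → (Fin k → ℕ) → ℕ
sumFin {zero}  f = 0
sumFin {suc k} f = f zero + sumFin (λ i → f (suc i))

_≅_ : ∀ {n} → Graph n → Graph n → Set
_≅_ {n} H G = Σ (Fin n ↔ Fin n) λ σ →
  ∀ i j → H i j ≡ G (Inverse.to σ i) (Inverse.to σ j)

-- Random Apollonian Networks (combinatorial description of the
-- planar process).  A state consists of a graph together with the list
-- of its bounded triangular faces.  Starting from a triangle (one
-- bounded face), one repeatedly picks a bounded face {a,b,c}, inserts a
-- new vertex into it, joins it to a, b, c, and the face {a,b,c} is
-- replaced by the three faces {v,a,b}, {v,b,c}, {v,a,c}.
-- The new vertex is 'zero'; old vertex i becomes 'suc i'.

Face : ℕ → Set
Face n = Fin n × Fin n × Fin n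

inFace : ∀ {n} → Fin n → Face n → Bool
inFace j (a , b , c) = ⌊ j ≟ a ⌋ ∨ ⌊ j ≟ b ⌋ ∨ ⌊ j ≟ c ⌋

triangle : Graph 3
triangle i j = Data.Bool.not ⌊ i ≟ j ⌋
  where import Data.Bool

insertVertex : ∀ {n} → Graph n → Face n → Graph (suc n)
insertVertex G f zero    zero    = false
insertVertex G f zero    (suc j) = inFace j f
insertVertex G f (suc i) zero    = inFace i f
insertVertex G f (suc i) (suc j) = G i j

liftFace : ∀ {n} → Face n → Face (suc n)
liftFace (a , b , c) = suc a , suc b , suc c

liftFaces : ∀ {n} → List (Face n) → List (Face (suc n))
liftFaces []       = []
liftFaces (f ∷ fs) = liftFace f ∷ liftFaces fs

newFaces : ∀ {n} → Face n → List (Face (suc n))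
newFaces (a , b , c) =
  (zero , suc a , suc b) ∷ (zero , suc b , suc c) ∷ (zero , suc a , suc c) ∷ []

_++ₗ_ : ∀ {A : Set} → List A → List A → List A
[] ++ₗ ys = ys
(x ∷ xs) ++ₗ ys = x ∷ (xs ++ₗ ys)

data RANState : (n : ℕ) → Graph n → List (Face n) → Set where
  start  : RANState 3 triangle ((zero , suc zero , suc (suc zero)) ∷ [])
  insert : ∀ {n G F} {f : Face n} → RANState n G F → (p : f ∈ₗ F) →
           RANState (suc n) (insertVertex G f)
                    (newFaces f ++ₗ liftFaces (F ─ p))

IsRAN : ∀ {n} → Graph n → Set
IsRAN {n} G = Σ (Graph n) λ H → Σ (List (Face n)) λ F → RANState n H F × (H ≅ G)

IsClique : ∀ {n} → Graph n → Subset n → Set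
IsClique G S = ∀ {i j} → i ∈ S → j ∈ S → i ≢ j → G i j ≡ true

IsMaximalClique : ∀ {n} → Graph n → Subset n → Set
IsMaximalClique G S = IsClique G S × (∀ T → IsClique G T → S ⊆ T → T ⊆ S)

-- An enumeration (without repetition) of all maximal cliques of G;
-- these are the vertices of the clique-intersection graph.
record CliqueEnum {n} (G : Graph n) : Set where
  field
    k     : ℕ
    K     : Fin k → Subset n
    K-max : ∀ i → IsMaximalClique G (K i)
    K-inj : ∀ i j → K i ≡ K j → i ≡ j
    K-all : ∀ S → IsMaximalClique G S → ∃ λ i → K i ≡ S

data Reach {k} (T : Graph k) : Fin k → Fin k → Set where
  here : ∀ {i} → Reach T i i
  step : ∀ {i l j} → T i l ≡ true → Reach T l j → Reach T i j

record Cycle {k} (T : Graph k) : Set where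
  field
    m      : ℕ
    m≥2    : 2 ≤ m
    v      : Fin (suc m) → Fin k
    v-inj  : ∀ a b → v a ≡ v b → a ≡ b
    v-adj  : ∀ (a : Fin m) → T (v (inject₁ a)) (v (suc a)) ≡ true
    v-close : T (v (fromℕ m)) (v zero) ≡ true

IsSimple : ∀ {k} → Graph k → Set
IsSimple T = (∀ i j → T i j ≡ T j i) × (∀ i → T i i ≡ false)

IsTree : ∀ {k} → Graph k → Set
IsTree T = IsSimple T × (∀ i j → Reach T i j) × ¬ Cycle T

degree : ∀ {k} → Graph k → Fin k → ℕ
degree T i = sumFin (λ j → if T i j then 1 else 0)

IsFourRegular : ∀ {k} → Graph k → Set
IsFourRegular T = ∀ i → 2 ≤ degree T i → degree T i ≡ 4

-- Clique-trees: maximum-weight spanning trees of the clique-intersection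
-- graph (edges between intersecting maximal cliques, weight = size of
-- the intersection).

module _ {n} {G : Graph n} (E : CliqueEnum G) where
  open CliqueEnum E

  IsSpanningTreeCI : Graph k → Set
  IsSpanningTreeCI T = IsTree T × (∀ i j → T i j ≡ true → 0 < ∣ K i ∩ K j ∣)

  weight : Graph k → ℕ
  weight T = sumFin λ i → sumFin λ j →
    if T i j ∧ ⌊ toℕ i Data.Nat.<? toℕ j ⌋ then ∣ K i ∩ K j ∣ else 0
    where import Data.Nat

  IsCliqueTree : Graph k → Set
  IsCliqueTree T = IsSpanningTreeCI T ×
                   (∀ T' → IsSpanningTreeCI T' → weight T' ≤ weight T)

-- Vertices 0..4 form the triangular
-- bipyramid (K₅ minus the edge {0,1}): apexes 0, 1 and equator 2, 3, 4.
-- Its six faces are {a,x,y} with a ∈ {0,1}, {x,y} ⊂ {2,3,4}; vertices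
-- 5..10 are inserted into the faces
--   5:{0,2,3}  6:{0,3,4}  7:{0,2,4}  8:{1,2,3}  9:{1,3,4}  10:{1,2,4}.

ghEdges : List (ℕ × ℕ)
ghEdges =
  (2 , 3) ∷ (3 , 4) ∷ (2 , 4) ∷
  (0 , 2) ∷ (0 , 3) ∷ (0 , 4) ∷ (1 , 2) ∷ (1 , 3) ∷ (1 , 4) ∷
  (5 , 0) ∷ (5 , 2) ∷ (5 , 3) ∷
  (6 , 0) ∷ (6 , 3) ∷ (6 , 4) ∷
  (7 , 0) ∷ (7 , 2) ∷ (7 , 4) ∷
  (8 , 1) ∷ (8 , 2) ∷ (8 , 3) ∷
  (9 , 1) ∷ (9 , 3) ∷ (9 , 4) ∷
  (10 , 1) ∷ (10 , 2) ∷ (10 , 4) ∷ []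

goldnerHarary : Graph 11
goldnerHarary i j = any edge ghEdges
  where
  open import Data.Nat using (_≡ᵇ_)
  edge : ℕ × ℕ → Bool
  edge (a , b) = ((a ≡ᵇ toℕ i) ∧ (b ≡ᵇ toℕ j)) ∨ ((a ≡ᵇ toℕ j) ∧ (b ≡ᵇ toℕ i))

-- The class C₁: RANs on at least 6 vertices whose clique-tree is
-- 4-regular.  (A clique-tree exists, and every clique-tree — it is
-- unique for RANs — is 4-regular.)

InC1 : ∀ {n} → Graph n → Set
InC1 {n} G =
  6 ≤ n × IsRAN G ×
  (Σ (CliqueEnum G) λ E → Σ (Graph (CliqueEnum.k E)) (IsCliqueTree E)) ×
  (∀ (E : CliqueEnum G) (T : Graph (CliqueEnum.k E)) →
     IsCliqueTree E T → IsFourRegular T)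

module Submission where

-- It is a RAN: an explicit run of
-- the insertion process, relabelled, produces it.  Its maximal cliques are
-- the halves {0,2,3,4}, {1,2,3,4} of the bipyramid and the six K₄'s formed
-- by an inserted vertex with its face.  Distinct ones share at most 3
-- vertices, exactly 3 along the edges of a tree 'ghTree' with two hubs of
-- degree 4 and six leaves.  A forest on 8 vertices has at most 7 edges, so
-- every spanning tree weighs at most 7 · 3 = 21 and ghTree, weighing 21, is
-- a clique-tree.  Conversely a clique-tree weighs 21, so its 7 edges all
-- have weight 3, hence lie in ghTree, and its degrees are those of ghTree.

open import Defs

open import Data.Nat using (ℕ; zero; suc; _+_; _*_; _∸_; _≤_; _<_; _≤?_; _<?_; _≡ᵇ_; z≤n; s≤s)
open import Data.Nat.Properties
  using ( +-*-semiring; +-mono-≤; +-monoˡ-≤; +-monoʳ-≤; +-cancelˡ-≤; +-cancelʳ-≤; +-suc; +-comm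
        ; +-identityʳ; *-identityʳ; *-zeroʳ; *-distribˡ-+; *-cancelˡ-≤; *-monoʳ-≤
        ; ≤-antisym; ≤-reflexive; ≤-trans; <⇒≱; <-asym; ≮⇒≥; m≤m+n; module ≤-Reasoning )
  renaming (_≟_ to _≟ₙ_)
open import Data.Bool using (Bool; true; false; if_then_else_; _∧_; _∨_)
open import Data.Bool.ListAction using (any)
open import Data.Bool.Properties using () renaming (_≟_ to _≟ᵇ_)
open import Data.Fin using (Fin; zero; suc; toℕ; inject₁; fromℕ; #_)
open import Data.Fin.Properties
  using (all?; any?; injective⇒≤; suc-injective; toℕ-injective) renaming (_≟_ to _≟ᶠ_)
open import Data.Fin.Permutation
  using (Permutation; Permutation′; permutation; _⟨$⟩ʳ_; _⟨$⟩ˡ_; inverseˡ; inverseʳ; transpose; ↔⇒≡)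
open import Data.Fin.Subset using (Subset; _∈_; _⊆_; _∩_; ∣_∣)
open import Data.Fin.Subset.Properties
  using (anySubset?; _∈?_; _⊆?_; ∩-comm; ⊆-trans; ⊆-antisym; ⊆-reflexive)
open import Data.List using (List; []; _∷_)
open import Data.List.Membership.Propositional using () renaming (_∈_ to _∈ₗ_)
open import Data.List.Relation.Unary.Any using (here; there)
open import Data.Vec using (Vec; []; _∷_; lookup; tabulate; head)
open import Data.Vec.Membership.Propositional using () renaming (_∈_ to _∈ᵥ_; _∉_ to _∉ᵥ_)
open import Data.Vec.Relation.Unary.All as All using (All; []; _∷_)
open import Data.Vec.Relation.Unary.AllPairs using ([]; _∷_)
open import Data.Vec.Relation.Unary.Any using (here; there)
open import Data.Vec.Relation.Unary.Linked using (Linked; []; [-]; _∷_)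
open import Data.Vec.Relation.Unary.Unique.Propositional using (Unique)
open import Data.Vec.Relation.Unary.Unique.Propositional.Properties using (lookup-injective)
open import Data.Product using (Σ; ∃; _×_; _,_; proj₁; proj₂)
open import Data.Sum using (_⊎_; inj₁; inj₂)
open import Data.Empty using (⊥; ⊥-elim)
open import Relation.Nullary using (¬_; Dec; yes; no)
open import Relation.Nullary.Decidable
  using (⌊_⌋; toWitness; toWitnessFalse; decidable-stable; ¬?; _×-dec_; _⊎-dec_; _→-dec_)
open import Relation.Binary.PropositionalEquality
open import Function using (_∘_)
open import Function.Bundles using (Injection)
open import Function.Definitions using (Injective)
open import Function.Properties.Inverse using (↔⇒↣)
import Algebra.Properties.Semiring.Sum as SemiringSum

-- Finite sums.  'sumFin' from Defs is the library's 'sum' over vectors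
-- 'Fin n → ℕ', which lets us reuse its algebraic laws.

private module Σℕ = SemiringSum +-*-semiring

sumFin≡sum : ∀ {n} (f : Fin n → ℕ) → sumFin f ≡ Σℕ.sum f
sumFin≡sum {zero}  f = refl
sumFin≡sum {suc n} f = cong (f zero +_) (sumFin≡sum (f ∘ suc))

sumFin-cong : ∀ {n} {f g : Fin n → ℕ} → (∀ i → f i ≡ g i) → sumFin f ≡ sumFin g
sumFin-cong {zero}  f≗g = refl
sumFin-cong {suc n} f≗g = cong₂ _+_ (f≗g zero) (sumFin-cong (f≗g ∘ suc))

sumFin-+ : ∀ {n} (f g : Fin n → ℕ) → sumFin (λ i → f i + g i) ≡ sumFin f + sumFin g
sumFin-+ f g = begin
  sumFin (λ i → f i + g i)  ≡⟨ sumFin≡sum (λ i → f i + g i) ⟩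
  Σℕ.sum (λ i → f i + g i)  ≡⟨ Σℕ.∑-distrib-+ f g ⟩
  Σℕ.sum f + Σℕ.sum g       ≡⟨ sym (cong₂ _+_ (sumFin≡sum f) (sumFin≡sum g)) ⟩
  sumFin f + sumFin g       ∎
  where open ≡-Reasoning

sumFin-*ˡ : ∀ {n} (c : ℕ) (f : Fin n → ℕ) → sumFin (λ i → c * f i) ≡ c * sumFin f
sumFin-*ˡ c f = begin
  sumFin (λ i → c * f i)  ≡⟨ sumFin≡sum (λ i → c * f i) ⟩
  Σℕ.sum (λ i → c * f i)  ≡⟨ sym (Σℕ.*-distribˡ-sum c f) ⟩
  c * Σℕ.sum f            ≡⟨ sym (cong (c *_) (sumFin≡sum f)) ⟩
  c * sumFin f            ∎
  where open ≡-Reasoning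

sumFin-swap : ∀ {m n} (f : Fin m → Fin n → ℕ) →
  sumFin (λ i → sumFin (f i)) ≡ sumFin (λ j → sumFin (λ i → f i j))
sumFin-swap f = begin
  sumFin (λ i → sumFin (f i))               ≡⟨ sumFin-cong (λ i → sumFin≡sum (f i)) ⟩
  sumFin (λ i → Σℕ.sum (f i))               ≡⟨ sumFin≡sum (λ i → Σℕ.sum (f i)) ⟩
  Σℕ.sum (λ i → Σℕ.sum (f i))               ≡⟨ Σℕ.∑-comm f ⟩
  Σℕ.sum (λ j → Σℕ.sum (λ i → f i j))       ≡⟨ sym (sumFin≡sum (λ j → Σℕ.sum (λ i → f i j))) ⟩
  sumFin (λ j → Σℕ.sum (λ i → f i j))       ≡⟨ sym (sumFin-cong (λ j → sumFin≡sum (λ i → f i j))) ⟩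
  sumFin (λ j → sumFin (λ i → f i j))       ∎
  where open ≡-Reasoning

sumFin-permute : ∀ {m n} (π : Permutation m n) (f : Fin n → ℕ) →
  sumFin f ≡ sumFin (λ i → f (π ⟨$⟩ʳ i))
sumFin-permute π f = begin
  sumFin f                     ≡⟨ sumFin≡sum f ⟩
  Σℕ.sum f                     ≡⟨ Σℕ.sum-permute f π ⟩
  Σℕ.sum (λ i → f (π ⟨$⟩ʳ i))  ≡⟨ sym (sumFin≡sum (λ i → f (π ⟨$⟩ʳ i))) ⟩
  sumFin (λ i → f (π ⟨$⟩ʳ i))  ∎
  where open ≡-Reasoning

sumFin-mono : ∀ {n} {f g : Fin n → ℕ} → (∀ i → f i ≤ g i) → sumFin f ≤ sumFin g
sumFin-mono {zero}  f≤g = z≤n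
sumFin-mono {suc n} f≤g = +-mono-≤ (f≤g zero) (sumFin-mono (f≤g ∘ suc))

sumFin-tight : ∀ {n} {f g : Fin n → ℕ} → (∀ i → f i ≤ g i) → sumFin g ≤ sumFin f →
  ∀ i → f i ≡ g i
sumFin-tight {suc n} {f} {g} f≤g Σg≤Σf zero =
  ≤-antisym (f≤g zero) (+-cancelʳ-≤ _ (g zero) (f zero)
    (≤-trans Σg≤Σf (+-monoʳ-≤ (f zero) (sumFin-mono (f≤g ∘ suc)))))
sumFin-tight {suc n} {f} {g} f≤g Σg≤Σf (suc i) =
  sumFin-tight (f≤g ∘ suc)
    (+-cancelˡ-≤ (f zero) _ _ (≤-trans (+-monoˡ-≤ _ (f≤g zero)) Σg≤Σf)) i

sumFin²-tight : ∀ {m n} {f g : Fin m → Fin n → ℕ} → (∀ i j → f i j ≤ g i j) →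
  sumFin (λ i → sumFin (g i)) ≤ sumFin (λ i → sumFin (f i)) → ∀ i j → f i j ≡ g i j
sumFin²-tight f≤g Σg≤Σf i =
  sumFin-tight (f≤g i) (≤-reflexive (sym (sumFin-tight (λ i → sumFin-mono (f≤g i)) Σg≤Σf i)))

indicator : Bool → ℕ
indicator b = if b then 1 else 0

count : ∀ {n} → (Fin n → Bool) → ℕ
count b = sumFin (λ i → indicator (b i))

count-none : ∀ {n} (b : Fin n → Bool) → (∀ i → b i ≡ false) → count b ≡ 0
count-none {zero}  b none = refl
count-none {suc n} b none rewrite none zero = count-none (b ∘ suc) (none ∘ suc)

count-atMostOne : ∀ {n} (b : Fin n → Bool) →
  (∀ i j → b i ≡ true → b j ≡ true → i ≡ j) → count b ≤ 1
count-atMostOne {zero}  b unique = z≤n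
count-atMostOne {suc n} b unique with b zero in b₀
... | true  = s≤s (≤-reflexive (count-none (b ∘ suc) others))
  where
  others : ∀ i → b (suc i) ≡ false
  others i with b (suc i) in bᵢ
  ... | false = refl
  ... | true  with unique zero (suc i) b₀ bᵢ
  ...   | ()
... | false = count-atMostOne (b ∘ suc) (λ i j bᵢ bⱼ → suc-injective (unique (suc i) (suc j) bᵢ bⱼ))

Edge : ∀ {k} → Graph k → Fin k → Fin k → Set
Edge T x y = T x y ≡ true

module _ {k} {T : Graph k} (T-simple : IsSimple T) where

  Edge-sym : ∀ {x y} → Edge T x y → Edge T y x
  Edge-sym {x} {y} e = trans (proj₁ T-simple y x) e

  Edge-irrefl : ∀ {x} → ¬ Edge T x x
  Edge-irrefl {x} e with trans (sym e) (proj₂ T-simple x)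
  ... | ()

degreeSum : ∀ {k} → Graph k → ℕ
degreeSum T = sumFin (degree T)

-- The graph induced on Fin k by a map into the vertices of T; along an
-- injective map this is an isomorphic copy of an induced subgraph.
pullback : ∀ {k l} → (Fin k → Fin l) → Graph l → Graph k
pullback f T i j = T (f i) (f j)

module _ {k l} (f : Fin k → Fin l) {T : Graph l} where

  pullback-simple : IsSimple T → IsSimple (pullback f T)
  pullback-simple (T-sym , T-irr) = (λ i j → T-sym (f i) (f j)) , (λ i → T-irr (f i))

  -- A cycle of the pullback maps to a cycle of T.
  pullback-acyclic : Injective _≡_ _≡_ f → ¬ Cycle T → ¬ Cycle (pullback f T)
  pullback-acyclic f-inj T-acyclic C = T-acyclic record
    { m = m ; m≥2 = m≥2 ; v = f ∘ v
    ; v-inj = λ a b e → v-inj a b (f-inj e) ; v-adj = v-adj ; v-close = v-close }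
    where open Cycle C

Reach-trans : ∀ {k} {T : Graph k} {x y z} → Reach T x y → Reach T y z → Reach T x z
Reach-trans here         q = q
Reach-trans (step e p) q = step e (Reach-trans p q)

Reach-sym : ∀ {k} {T : Graph k} → IsSimple T → ∀ {x y} → Reach T x y → Reach T y x
Reach-sym T-simple here       = here
Reach-sym T-simple (step e p) = Reach-trans (Reach-sym T-simple p) (step (Edge-sym T-simple e) here)

permutation-injective : ∀ {k l} (π : Permutation k l) → Injective _≡_ _≡_ (π ⟨$⟩ʳ_)
permutation-injective π = Injection.injective (↔⇒↣ π)

module _ {k l} (π : Permutation k l) (T : Graph l) where

  private
    T′ : Graph k
    T′ = pullback (π ⟨$⟩ʳ_) T

  degree-relabel : ∀ i → degree T′ i ≡ degree T (π ⟨$⟩ʳ i)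
  degree-relabel i = sym (sumFin-permute π (λ c → indicator (T (π ⟨$⟩ʳ i) c)))

  degreeSum-relabel : degreeSum T′ ≡ degreeSum T
  degreeSum-relabel = trans (sumFin-cong degree-relabel) (sym (sumFin-permute π (degree T)))

  connected-relabel : (∀ c d → Reach T c d) → ∀ i j → Reach T′ i j
  connected-relabel T-conn i j =
    subst₂ (Reach T′) (inverseˡ π) (inverseˡ π) (lift (T-conn (π ⟨$⟩ʳ i) (π ⟨$⟩ʳ j)))
    where
    lift : ∀ {c d} → Reach T c d → Reach T′ (π ⟨$⟩ˡ c) (π ⟨$⟩ˡ d)
    lift here = here
    lift (step e p) = step (subst₂ (Edge T) (sym (inverseʳ π)) (sym (inverseʳ π)) e) (lift p)

-- Removing vertex zero from a simple graph loses its edges twice in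
-- the degree sum.
degreeSum-split : ∀ {n} (T : Graph (suc n)) → IsSimple T →
  degreeSum T ≡ degree T zero + (degree T zero + degreeSum (pullback suc T))
degreeSum-split {n} T (T-sym , T-irr) = cong (degree T zero +_) (begin
  sumFin (λ i → indicator (T (suc i) zero) + degree T⁻ i)
    ≡⟨ sumFin-+ (λ i → indicator (T (suc i) zero)) (degree T⁻) ⟩
  sumFin (λ i → indicator (T (suc i) zero)) + degreeSum T⁻
    ≡⟨ cong (_+ degreeSum T⁻) (sumFin-cong (λ i → cong indicator (T-sym (suc i) zero))) ⟩
  sumFin (λ i → indicator (T zero (suc i))) + degreeSum T⁻
    ≡⟨ cong (_+ degreeSum T⁻) (sym degree-zero) ⟩
  degree T zero + degreeSum T⁻ ∎)
  where
  open ≡-Reasoning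
  T⁻ : Graph n
  T⁻ = pullback suc T
  -- vertex zero has no loop
  degree-zero : degree T zero ≡ sumFin (λ i → indicator (T zero (suc i)))
  degree-zero rewrite T-irr zero = refl

IsPath : ∀ {K} → Graph K → ∀ {n} → Vec (Fin K) n → Set
IsPath T xs = Unique xs × Linked (Edge T) xs

-- Every finite nonempty forest has a vertex of degree at most one: the
-- far end of a maximal path.
module _ {K} (T : Graph K) (T-simple : IsSimple T) (T-acyclic : ¬ Cycle T) where

  private
    open import Data.Vec.Membership.DecPropositional (_≟ᶠ_ {K}) using () renaming (_∈?_ to _∈ᵥ?_)

    linked-lookup : ∀ {n} {xs : Vec (Fin K) (suc n)} → Linked (Edge T) xs →
      ∀ a → Edge T (lookup xs (inject₁ a)) (lookup xs (suc a))
    linked-lookup {xs = x ∷ y ∷ xs} (e ∷ es) zero    = e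
    linked-lookup {xs = x ∷ y ∷ xs} (e ∷ es) (suc a) = linked-lookup es a

    all-⊆ : ∀ {P : Fin K → Set} {n m} {xs : Vec (Fin K) n} {ys : Vec (Fin K) m} →
      All P ys → (∀ {s} → s ∈ᵥ xs → s ∈ᵥ ys) → All P xs
    all-⊆ {xs = []}     P-ys sub = []
    all-⊆ {xs = x ∷ xs} P-ys sub = All.lookup P-ys (sub (here refl)) ∷ all-⊆ P-ys (sub ∘ there)

    fresh : ∀ {n y} {xs : Vec (Fin K) n} → y ∉ᵥ xs → All (y ≢_) xs
    fresh {xs = []}     y∉ = []
    fresh {xs = x ∷ xs} y∉ = (λ y≡x → y∉ (here y≡x)) ∷ fresh (y∉ ∘ there)

  closedPath-impossible : ∀ {r} (xs : Vec (Fin K) (3 + r)) → IsPath T xs →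
    ¬ Edge T (lookup xs (fromℕ (2 + r))) (lookup xs zero)
  closedPath-impossible {r} xs (xs-unique , xs-linked) close = T-acyclic record
    { m = 2 + r ; m≥2 = s≤s (s≤s z≤n) ; v = lookup xs
    ; v-inj = lookup-injective xs-unique ; v-adj = linked-lookup xs-linked ; v-close = close }

  record Segment (z y : Fin K) {n} (zs : Vec (Fin K) n) : Set where
    field
      len    : ℕ
      vs     : Vec (Fin K) (suc len)
      starts : head vs ≡ z
      ends   : lookup vs (fromℕ len) ≡ y
      path   : IsPath T vs
      within : ∀ {t} → t ∈ᵥ vs → t ∈ᵥ z ∷ zs

  segment : ∀ {n y} z (zs : Vec (Fin K) n) → IsPath T (z ∷ zs) → y ∈ᵥ z ∷ zs → Segment z y zs
  segment z zs p (here refl) = record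
    { len = 0 ; vs = z ∷ [] ; starts = refl ; ends = refl ; path = [] ∷ [] , [-]
    ; within = λ { (here t≡z) → here t≡z } }
  segment z (z′ ∷ zs) (z-fresh ∷ zs-unique , zz′ ∷ zs-linked) (there y∈) = record
    { len = suc len ; vs = z ∷ vs ; starts = refl ; ends = ends
    ; path = all-⊆ z-fresh within ∷ proj₁ path , subst (Edge T z) (sym starts) zz′ ∷ proj₂ path
    ; within = λ { (here t≡z) → here t≡z ; (there t∈) → there (within t∈) } }
    where open Segment (segment z′ zs (zs-unique , zs-linked) y∈)

  noChord : ∀ {n x w y} {rest : Vec (Fin K) n} → IsPath T (x ∷ w ∷ rest) → Edge T x y → ¬ y ∈ᵥ rest
  noChord {x = x} {w} {rest = z ∷ zs} (x-fresh ∷ w-fresh ∷ zs-unique , xw ∷ wz ∷ zs-linked) xy y∈ =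
    closedPath-impossible (x ∷ w ∷ vs)
      ( (All.head x-fresh ∷ all-⊆ (All.tail x-fresh) within) ∷ all-⊆ w-fresh within ∷ proj₁ path
      , xw ∷ subst (Edge T w) (sym starts) wz ∷ proj₂ path )
      (subst (λ t → Edge T t x) (sym ends) (Edge-sym T-simple xy))
    where open Segment (segment z zs (zs-unique , zs-linked) y∈)

  -- If every neighbour of the head x of a path lies on the path, only the
  -- next vertex can be one, so x has degree at most one.
  endpoint-leaf : ∀ {n x} {xs : Vec (Fin K) n} → IsPath T (x ∷ xs) →
    (∀ y → Edge T x y → y ∈ᵥ x ∷ xs) → degree T x ≤ 1
  endpoint-leaf {x = x} {[]} p closed = count-atMostOne (T x) (λ y y′ e e′ → ⊥-elim (self y e))
    where
    self : ∀ y → ¬ Edge T x y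
    self y e with closed y e
    ... | here refl = Edge-irrefl T-simple e
  endpoint-leaf {x = x} {w ∷ rest} p closed =
    count-atMostOne (T x) (λ y y′ e e′ → trans (next y e) (sym (next y′ e′)))
    where
    next : ∀ y → Edge T x y → y ≡ w
    next y e with closed y e
    ... | here refl         = ⊥-elim (Edge-irrefl T-simple e)
    ... | there (here y≡w)  = y≡w
    ... | there (there y∈)  = ⊥-elim (noChord p e y∈)

  -- Extend a path at its head while the head has a neighbour off the path.
  -- A path has at most K vertices, so with enough fuel this stops at a leaf.
  grow : ∀ (fuel : ℕ) {m} x (xs : Vec (Fin K) m) → IsPath T (x ∷ xs) → K < fuel + suc m →
    ∃ λ v → degree T v ≤ 1
  grow zero x xs (xs-unique , _) K<len =
    ⊥-elim (<⇒≱ K<len (injective⇒≤ λ {i} {j} → lookup-injective xs-unique i j))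
  grow (suc fuel) {m} x xs p K<fuel+len with any? (λ y → (T x y ≟ᵇ true) ×-dec ¬? (y ∈ᵥ? x ∷ xs))
  ... | yes (y , xy , y∉) =
    grow fuel y (x ∷ xs)
      (fresh y∉ ∷ proj₁ p , Edge-sym T-simple xy ∷ proj₂ p)
      (subst (K <_) (sym (+-suc fuel (suc m))) K<fuel+len)
  ... | no stuck = x , endpoint-leaf p on-path
    where
    on-path : ∀ y → Edge T x y → y ∈ᵥ x ∷ xs
    on-path y xy = decidable-stable (y ∈ᵥ? x ∷ xs) (λ y∉ → stuck (y , xy , y∉))

  leaf : Fin K → ∃ λ v → degree T v ≤ 1
  leaf x = grow K x [] ([] ∷ [] , [-]) (≤-reflexive (+-comm 1 K))

delete-leaf : ∀ {k} (T : Graph (suc k)) → IsSimple T → ¬ Cycle T →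
  ∀ v → degree T v ≤ 1 →
  ∃ λ (T⁻ : Graph k) → (IsSimple T⁻ × ¬ Cycle T⁻) × degreeSum T ≤ 2 + degreeSum T⁻
delete-leaf {k} T T-simple T-acyclic v v-leaf =
  pullback suc T′ , (pullback-simple suc T′-simple , T⁻-acyclic) , (begin
    degreeSum T                                  ≡⟨ sym (degreeSum-relabel σ T) ⟩
    degreeSum T′                                 ≡⟨ degreeSum-split T′ T′-simple ⟩
    d + (d + degreeSum (pullback suc T′))        ≤⟨ +-mono-≤ d≤1 (+-monoˡ-≤ _ d≤1) ⟩
    2 + degreeSum (pullback suc T′)              ∎)
  where
  open ≤-Reasoning
  -- relabel so that the leaf v becomes vertex zero, then drop it
  σ : Permutation′ (suc k)
  σ = transpose zero v
  T′ : Graph (suc k)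
  T′ = pullback (σ ⟨$⟩ʳ_) T
  T′-simple : IsSimple T′
  T′-simple = pullback-simple (σ ⟨$⟩ʳ_) T-simple
  T⁻-acyclic : ¬ Cycle (pullback suc T′)
  T⁻-acyclic = pullback-acyclic suc suc-injective
    (pullback-acyclic (σ ⟨$⟩ʳ_) (permutation-injective σ) T-acyclic)
  d : ℕ
  d = degree T′ zero
  d≤1 : d ≤ 1
  d≤1 = ≤-trans (≤-reflexive (degree-relabel σ T zero)) v-leaf

forest-degreeSum : ∀ {m} (T : Graph m) → IsSimple T → ¬ Cycle T → degreeSum T ≤ 2 * (m ∸ 1)
forest-degreeSum {zero}        T T-simple T-acyclic = z≤n
forest-degreeSum {suc zero}    T (_ , T-irr) T-acyclic rewrite T-irr zero = z≤n
forest-degreeSum {suc (suc k)} T T-simple T-acyclic =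
  let v , v-leaf = leaf T T-simple T-acyclic zero
      T⁻ , (T⁻-simple , T⁻-acyclic) , T≤2+T⁻ = delete-leaf T T-simple T-acyclic v v-leaf
  in begin
    degreeSum T        ≤⟨ T≤2+T⁻ ⟩
    2 + degreeSum T⁻   ≤⟨ +-monoʳ-≤ 2 (forest-degreeSum T⁻ T⁻-simple T⁻-acyclic) ⟩
    2 + 2 * k          ≡⟨ sym (*-distribˡ-+ 2 1 k) ⟩
    2 * suc k          ∎
  where open ≤-Reasoning

module _ {k} {T T′ : Graph k} (T⊆T′ : ∀ i j → Edge T i j → Edge T′ i j) where

  subgraph-degree : ∀ i → degree T i ≤ degree T′ i
  subgraph-degree i = sumFin-mono entry
    where
    entry : ∀ j → indicator (T i j) ≤ indicator (T′ i j)
    entry j with T i j in ij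
    ... | false = z≤n
    ... | true rewrite T⊆T′ i j ij = ≤-reflexive refl

  subgraph-sameDegrees : degreeSum T′ ≤ degreeSum T → ∀ i → degree T i ≡ degree T′ i
  subgraph-sameDegrees = sumFin-tight subgraph-degree

module EdgeWeights {k} (w : Fin k → Fin k → ℕ) where

  incidenceWeight : Graph k → ℕ
  incidenceWeight T = sumFin λ i → sumFin λ j → if T i j then w i j else 0

  oriented : Graph k → Fin k → Fin k → ℕ
  oriented T i j = if T i j ∧ ⌊ toℕ i <? toℕ j ⌋ then w i j else 0

  -- Sum of w over the edges; for the clique-intersection weights this is
  -- 'weight' from Defs.
  edgeWeight : Graph k → ℕ
  edgeWeight T = sumFin λ i → sumFin λ j → oriented T i j

  module _ (w-sym : ∀ i j → w i j ≡ w j i) {T : Graph k} (T-simple : IsSimple T) where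

    orient : ∀ i j → (if T i j then w i j else 0) ≡ oriented T i j + oriented T j i
    orient i j rewrite proj₁ T-simple j i with T i j in ij
    ... | false = refl
    ... | true with toℕ i <? toℕ j | toℕ j <? toℕ i
    ...   | yes i<j | yes j<i = ⊥-elim (<-asym i<j j<i)
    ...   | yes i<j | no  _   = sym (+-identityʳ (w i j))
    ...   | no  _   | yes j<i = w-sym i j
    ...   | no  i≮j | no  j≮i with toℕ-injective (≤-antisym (≮⇒≥ j≮i) (≮⇒≥ i≮j))
    ...     | refl = ⊥-elim (Edge-irrefl T-simple ij)

    incidenceWeight≡2*edgeWeight : incidenceWeight T ≡ 2 * edgeWeight T
    incidenceWeight≡2*edgeWeight = begin
      incidenceWeight T
        ≡⟨ sumFin-cong (λ i → trans (sumFin-cong (orient i))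
                                     (sumFin-+ (oriented T i) (λ j → oriented T j i))) ⟩
      sumFin (λ i → sumFin (oriented T i) + sumFin (λ j → oriented T j i))
        ≡⟨ sumFin-+ (λ i → sumFin (oriented T i)) (λ i → sumFin (λ j → oriented T j i)) ⟩
      edgeWeight T + sumFin (λ i → sumFin (λ j → oriented T j i))
        ≡⟨ cong (edgeWeight T +_) (sym (sumFin-swap (oriented T))) ⟩
      edgeWeight T + edgeWeight T
        ≡⟨ cong (edgeWeight T +_) (sym (+-identityʳ (edgeWeight T))) ⟩
      2 * edgeWeight T ∎
      where open ≡-Reasoning

  scaledDegreeSum : ∀ b (T : Graph k) →
    sumFin (λ i → sumFin (λ j → b * indicator (T i j))) ≡ b * degreeSum T
  scaledDegreeSum b T =
    trans (sumFin-cong (λ i → sumFin-*ˡ b (λ j → indicator (T i j)))) (sumFin-*ˡ b (degree T))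

  incidenceWeight-uniform : ∀ b (T : Graph k) → (∀ i j → Edge T i j → w i j ≡ b) →
    incidenceWeight T ≡ b * degreeSum T
  incidenceWeight-uniform b T uniform =
    trans (sumFin-cong λ i → sumFin-cong (entry i)) (scaledDegreeSum b T)
    where
    entry : ∀ i j → (if T i j then w i j else 0) ≡ b * indicator (T i j)
    entry i j with T i j in ij
    ... | true  = trans (uniform i j ij) (sym (*-identityʳ b))
    ... | false = sym (*-zeroʳ b)

  module _ (b : ℕ) (w≤b : ∀ i j → i ≢ j → w i j ≤ b) {T : Graph k} (T-simple : IsSimple T) where

    private
      entry≤ : ∀ i j → (if T i j then w i j else 0) ≤ b * indicator (T i j)
      entry≤ i j with T i j in ij
      ... | true  = ≤-trans (w≤b i j (λ { refl → Edge-irrefl T-simple ij }))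
                            (≤-reflexive (sym (*-identityʳ b)))
      ... | false = z≤n

    incidenceWeight≤ : incidenceWeight T ≤ b * degreeSum T
    incidenceWeight≤ =
      ≤-trans (sumFin-mono (λ i → sumFin-mono (entry≤ i))) (≤-reflexive (scaledDegreeSum b T))

    incidenceWeight-tight : b * degreeSum T ≤ incidenceWeight T → ∀ i j → Edge T i j → w i j ≡ b
    incidenceWeight-tight b*D≤ i j ij =
      trans (subst (λ e → (if e then w i j else 0) ≡ b * indicator e) ij (tight i j)) (*-identityʳ b)
      where
      tight : ∀ i j → (if T i j then w i j else 0) ≡ b * indicator (T i j)
      tight = sumFin²-tight entry≤ (≤-trans (≤-reflexive (scaledDegreeSum b T)) b*D≤)

module MaximalCliques {n} (G : Graph n) {m} (C : Fin m → Subset n)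
  (C-clique : ∀ c → IsClique G (C c))
  (C-covers : ∀ S → IsClique G S → ∃ λ c → S ⊆ C c)
  (C-antichain : ∀ c d → C c ⊆ C d → c ≡ d) where

  C-maximal : ∀ c → IsMaximalClique G (C c)
  C-maximal c = C-clique c , no-extension
    where
    no-extension : ∀ S → IsClique G S → C c ⊆ S → S ⊆ C c
    no-extension S S-clique Cc⊆S with C-covers S S-clique
    ... | d , S⊆Cd with C-antichain c d (⊆-trans Cc⊆S S⊆Cd)
    ...   | refl = S⊆Cd

  maximal-listed : ∀ S → IsMaximalClique G S → ∃ λ c → C c ≡ S
  maximal-listed S (S-clique , S-maximal) with C-covers S S-clique
  ... | c , S⊆Cc = c , ⊆-antisym (S-maximal (C c) (C-clique c) S⊆Cc) S⊆Cc

  enumeration : CliqueEnum G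
  enumeration = record
    { k = m ; K = C ; K-max = C-maximal
    ; K-inj = λ c d Cc≡Cd → C-antichain c d (⊆-reflexive Cc≡Cd)
    ; K-all = maximal-listed }

three-among-two : ∀ {A : Set} {h₀ h₁ x y z : A} →
  x ≡ h₀ ⊎ x ≡ h₁ → y ≡ h₀ ⊎ y ≡ h₁ → z ≡ h₀ ⊎ z ≡ h₁ → x ≢ y → x ≢ z → y ≢ z → ⊥
three-among-two (inj₁ refl) (inj₁ refl) _           x≢y x≢z y≢z = x≢y refl
three-among-two (inj₂ refl) (inj₂ refl) _           x≢y x≢z y≢z = x≢y refl
three-among-two (inj₁ refl) (inj₂ refl) (inj₁ refl) x≢y x≢z y≢z = x≢z refl
three-among-two (inj₁ refl) (inj₂ refl) (inj₂ refl) x≢y x≢z y≢z = y≢z refl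
three-among-two (inj₂ refl) (inj₁ refl) (inj₁ refl) x≢y x≢z y≢z = y≢z refl
three-among-two (inj₂ refl) (inj₁ refl) (inj₂ refl) x≢y x≢z y≢z = x≢z refl

-- A simple graph in which only two vertices h₀, h₁ have two distinct
-- neighbours is acyclic: on a cycle v₀ v₁ … v_m, the vertices v₀, v₁
-- and v_m each have two distinct neighbours.
twoBranchVertices-acyclic : ∀ {k} {T : Graph k} → IsSimple T → (h₀ h₁ : Fin k) →
  (∀ x y z → y ≢ z → Edge T x y → Edge T x z → x ≡ h₀ ⊎ x ≡ h₁) → ¬ Cycle T
twoBranchVertices-acyclic {T = T} T-simple h₀ h₁ branch
  record { m = suc (suc m′) ; m≥2 = s≤s (s≤s z≤n)
         ; v = v ; v-inj = v-inj ; v-adj = v-adj ; v-close = v-close } =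
  three-among-two first second last (distinct 0≢1) (distinct 0≢last) (distinct 1≢last)
  where
  distinct : ∀ {a b} → a ≢ b → v a ≢ v b
  distinct a≢b e = a≢b (v-inj _ _ e)
  0≢1 : _≢_ {A = Fin (3 + m′)} zero (suc zero)
  0≢1 ()
  0≢last : zero ≢ fromℕ (suc (suc m′))
  0≢last ()
  1≢last : suc zero ≢ fromℕ (suc (suc m′))
  1≢last ()
  first : v zero ≡ h₀ ⊎ v zero ≡ h₁
  first = branch _ _ _ (distinct 1≢last) (v-adj zero) (Edge-sym T-simple v-close)
  second : v (suc zero) ≡ h₀ ⊎ v (suc zero) ≡ h₁
  second = branch _ _ _ (distinct (λ ())) (Edge-sym T-simple (v-adj zero)) (v-adj (suc zero))
  last : v (fromℕ (suc (suc m′))) ≡ h₀ ⊎ v (fromℕ (suc (suc m′))) ≡ h₁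
  last = branch _ _ _ (distinct (λ ())) v-close (Edge-sym T-simple (v-adj (fromℕ (suc m′))))

⟦_⟧ : ∀ {n} → List ℕ → Subset n
⟦ xs ⟧ = tabulate λ i → any (toℕ i ≡ᵇ_) xs

fromEdges : ∀ {n} → List (ℕ × ℕ) → Graph n
fromEdges es i j = any edge es
  where
  edge : ℕ × ℕ → Bool
  edge (a , b) = ((a ≡ᵇ toℕ i) ∧ (b ≡ᵇ toℕ j)) ∨ ((a ≡ᵇ toℕ j) ∧ (b ≡ᵇ toℕ i))

GH : Graph 11
GH = goldnerHarary

ghClique : Fin 8 → Subset 11
ghClique = lookup
  ( ⟦ 0 ∷ 2 ∷ 3 ∷ 4 ∷ [] ⟧ ∷ ⟦ 1 ∷ 2 ∷ 3 ∷ 4 ∷ [] ⟧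
  ∷ ⟦ 5 ∷ 0 ∷ 2 ∷ 3 ∷ [] ⟧ ∷ ⟦ 6 ∷ 0 ∷ 3 ∷ 4 ∷ [] ⟧ ∷ ⟦ 7 ∷ 0 ∷ 2 ∷ 4 ∷ [] ⟧
  ∷ ⟦ 8 ∷ 1 ∷ 2 ∷ 3 ∷ [] ⟧ ∷ ⟦ 9 ∷ 1 ∷ 3 ∷ 4 ∷ [] ⟧ ∷ ⟦ 10 ∷ 1 ∷ 2 ∷ 4 ∷ [] ⟧ ∷ [])

-- Cliques with explicit quantifiers, so that the property is decidable.
IsClique′ : Subset 11 → Set
IsClique′ S = ∀ i j → i ∈ S → j ∈ S → i ≢ j → Edge GH i j

clique′? : ∀ S → Dec (IsClique′ S)
clique′? S = all? λ i → all? λ j →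
  (i ∈? S) →-dec (j ∈? S) →-dec ¬? (i ≟ᶠ j) →-dec (GH i j ≟ᵇ true)

ghClique-clique : ∀ c → IsClique GH (ghClique c)
ghClique-clique c {i} {j} = toWitness {a? = all? λ c → clique′? (ghClique c)} _ c i j

-- Checked over all 2¹¹ vertex subsets: no clique escapes the list.
ghClique-cover : ∀ S → IsClique GH S → ∃ λ c → S ⊆ ghClique c
ghClique-cover S S-clique = decidable-stable (any? λ c → S ⊆? ghClique c)
  (λ uncovered → no-stray-clique (S , (λ i j → S-clique) , uncovered))
  where
  no-stray-clique : ¬ ∃ λ S → IsClique′ S × ¬ ∃ λ c → S ⊆ ghClique c
  no-stray-clique = toWitnessFalse
    {a? = anySubset? λ S → clique′? S ×-dec ¬? (any? λ c → S ⊆? ghClique c)} _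

ghClique-antichain : ∀ c d → ghClique c ⊆ ghClique d → c ≡ d
ghClique-antichain = toWitness
  {a? = all? λ c → all? λ d → (ghClique c ⊆? ghClique d) →-dec (c ≟ᶠ d)} _

module GHCliques = MaximalCliques GH ghClique ghClique-clique ghClique-cover ghClique-antichain

shared : Fin 8 → Fin 8 → ℕ
shared c d = ∣ ghClique c ∩ ghClique d ∣

-- The clique tree: cliques 0 and 1 (the halves of the bipyramid) are
-- joined, and every other clique hangs off the half containing its face.
ghTree : Graph 8
ghTree = fromEdges ((0 , 1) ∷ (0 , 2) ∷ (0 , 3) ∷ (0 , 4) ∷ (1 , 5) ∷ (1 , 6) ∷ (1 , 7) ∷ [])

shared≤3 : ∀ c d → c ≢ d → shared c d ≤ 3
shared≤3 = toWitness {a? = all? λ c → all? λ d → ¬? (c ≟ᶠ d) →-dec (shared c d ≤? 3)} _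

shared≡3⇒edge : ∀ c d → shared c d ≡ 3 → Edge ghTree c d
shared≡3⇒edge = toWitness {a? = all? λ c → all? λ d → (shared c d ≟ₙ 3) →-dec (ghTree c d ≟ᵇ true)} _

edge⇒shared≡3 : ∀ c d → Edge ghTree c d → shared c d ≡ 3
edge⇒shared≡3 = toWitness {a? = all? λ c → all? λ d → (ghTree c d ≟ᵇ true) →-dec (shared c d ≟ₙ 3)} _

ghTree-simple : IsSimple ghTree
ghTree-simple = toWitness
  {a? = (all? λ i → all? λ j → ghTree i j ≟ᵇ ghTree j i) ×-dec (all? λ i → ghTree i i ≟ᵇ false)} _

ghTree-branching : ∀ x y z → y ≢ z → Edge ghTree x y → Edge ghTree x z → x ≡ # 0 ⊎ x ≡ # 1
ghTree-branching = toWitness {a? = all? λ x → all? λ y → all? λ z →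
  ¬? (y ≟ᶠ z) →-dec (ghTree x y ≟ᵇ true) →-dec (ghTree x z ≟ᵇ true) →-dec
  ((x ≟ᶠ # 0) ⊎-dec (x ≟ᶠ # 1))} _

ghTree-connected : ∀ c d → Reach ghTree c d
ghTree-connected c d = Reach-trans (toHub c) (Reach-sym ghTree-simple (toHub d))
  where
  nearHub : ∀ c → c ≡ # 0 ⊎ Edge ghTree c (# 0) ⊎ Edge ghTree c (# 1)
  nearHub = toWitness {a? = all? λ c →
    (c ≟ᶠ # 0) ⊎-dec (ghTree c (# 0) ≟ᵇ true) ⊎-dec (ghTree c (# 1) ≟ᵇ true)} _
  toHub : ∀ c → Reach ghTree c (# 0)
  toHub c with nearHub c
  ... | inj₁ refl       = here
  ... | inj₂ (inj₁ c~0) = step c~0 here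
  ... | inj₂ (inj₂ c~1) = step {l = # 1} c~1 (step refl here)

ghTree-acyclic : ¬ Cycle ghTree
ghTree-acyclic = twoBranchVertices-acyclic ghTree-simple (# 0) (# 1) ghTree-branching

ghTree-degreeSum : degreeSum ghTree ≡ 14
ghTree-degreeSum = refl

ghTree-degrees : ∀ c → degree ghTree c ≡ 1 ⊎ degree ghTree c ≡ 4
ghTree-degrees = toWitness {a? = all? λ c → (degree ghTree c ≟ₙ 1) ⊎-dec (degree ghTree c ≟ₙ 4)} _

RANGraph : ℕ → Set
RANGraph n = Σ (Graph n) λ G → Σ (List (Face n)) λ F → RANState n G F

faces : ∀ {n} → RANGraph n → List (Face n)
faces (G , F , run) = F

infixl 5 _▷_
_▷_ : ∀ {n} (s : RANGraph n) {f : Face n} → f ∈ₗ faces s → RANGraph (suc n)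
(G , F , run) ▷ p = _ , _ , insert run p

-- The run producing the Goldner–Harary graph (the three new faces of a
-- step come first in the face list).
ghRun : RANGraph 11
ghRun = (triangle , _ , start)
  ▷ here refl
  ▷ here refl
  ▷ here refl
  ▷ there (there (there (here refl)))
  ▷ there (there (there (there (there (there (here refl))))))
  ▷ here refl
  ▷ there (there (there (here refl)))
  ▷ there (there (there (there (there (there (here refl))))))

ghRunGraph : Graph 11
ghRunGraph = proj₁ ghRun

-- The run creates vertices 8, 9, 10 (the triangle) and then 7, 6, …, 0.
-- The relabelling σ names them as in the Goldner–Harary graph: the run
-- starts from the triangle {0, 2, 5} and inserts 3, 4, 6, 7, 1, 9, 8, 10
-- into the faces {0,2,5}, {0,2,3}, {0,3,4}, {0,2,4}, {2,3,4}, {1,3,4},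
-- {1,2,3}, {1,2,4}.
σ : Permutation′ 11
σ = permutation (lookup to) (lookup from)
      (toWitness {a? = all? λ i → lookup to (lookup from i) ≟ᶠ i} _)
      (toWitness {a? = all? λ i → lookup from (lookup to i) ≟ᶠ i} _)
  where
  to from : Vec (Fin 11) 11
  to   = # 10 ∷ # 8 ∷ # 9 ∷ # 1 ∷ # 7 ∷ # 6 ∷ # 4 ∷ # 3 ∷ # 0 ∷ # 2 ∷ # 5 ∷ []
  from = # 8 ∷ # 3 ∷ # 9 ∷ # 7 ∷ # 6 ∷ # 10 ∷ # 5 ∷ # 4 ∷ # 1 ∷ # 2 ∷ # 0 ∷ []

ghRun-σ : ghRunGraph ≅ GH
ghRun-σ = σ , toWitness {a? = all? λ i → all? λ j → ghRunGraph i j ≟ᵇ GH (σ ⟨$⟩ʳ i) (σ ⟨$⟩ʳ j)} _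

gh-isRAN : IsRAN GH
gh-isRAN = ghRunGraph , proj₁ (proj₂ ghRun) , proj₂ (proj₂ ghRun) , ghRun-σ

-- Any enumeration E of the maximal cliques of the Goldner–Harary graph is
-- a relabelling of ghClique; the clique tree of E is the corresponding
-- relabelling of ghTree, and it is the only one.
module CliqueTreesOf (E : CliqueEnum GH) where
  open CliqueEnum E
  open EdgeWeights (λ i j → ∣ K i ∩ K j ∣)

  label : Fin k → Fin 8
  label i = proj₁ (GHCliques.maximal-listed (K i) (K-max i))

  label-K : ∀ i → ghClique (label i) ≡ K i
  label-K i = proj₂ (GHCliques.maximal-listed (K i) (K-max i))

  position : Fin 8 → Fin k
  position c = proj₁ (K-all (ghClique c) (GHCliques.C-maximal c))

  position-K : ∀ c → K (position c) ≡ ghClique c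
  position-K c = proj₂ (K-all (ghClique c) (GHCliques.C-maximal c))

  relabelling : Permutation k 8
  relabelling = permutation label position
    (λ c → ghClique-antichain _ _ (⊆-reflexive (trans (label-K (position c)) (position-K c))))
    (λ i → K-inj _ _ (trans (position-K (label i)) (label-K i)))

  k≡8 : k ≡ 8
  k≡8 = ↔⇒≡ relabelling

  shared-K : ∀ i j → ∣ K i ∩ K j ∣ ≡ shared (label i) (label j)
  shared-K i j = sym (cong₂ (λ S S′ → ∣ S ∩ S′ ∣) (label-K i) (label-K j))

  shared-K≤3 : ∀ i j → i ≢ j → ∣ K i ∩ K j ∣ ≤ 3
  shared-K≤3 i j i≢j = ≤-trans (≤-reflexive (shared-K i j))
    (shared≤3 (label i) (label j) (λ e → i≢j (permutation-injective relabelling e)))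

  shared-K-sym : ∀ i j → ∣ K i ∩ K j ∣ ≡ ∣ K j ∩ K i ∣
  shared-K-sym i j = cong ∣_∣ (∩-comm (K i) (K j))

  tree : Graph k
  tree = pullback label ghTree

  tree-edges : ∀ i j → Edge tree i j → ∣ K i ∩ K j ∣ ≡ 3
  tree-edges i j e = trans (shared-K i j) (edge⇒shared≡3 (label i) (label j) e)

  tree-simple : IsSimple tree
  tree-simple = pullback-simple label ghTree-simple

  tree-spanning : IsSpanningTreeCI E tree
  tree-spanning =
    ( tree-simple
    , connected-relabel relabelling ghTree ghTree-connected
    , pullback-acyclic label (permutation-injective relabelling) ghTree-acyclic )
    , λ i j e → subst (0 <_) (sym (tree-edges i j e)) (s≤s z≤n)

  tree-degreeSum : degreeSum tree ≡ 14
  tree-degreeSum = trans (degreeSum-relabel relabelling ghTree) ghTree-degreeSum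

  -- Every edge of tree has weight 3, and it has 7 edges.
  tree-weight : 2 * weight E tree ≡ 42
  tree-weight = begin
    2 * weight E tree      ≡⟨ sym (incidenceWeight≡2*edgeWeight shared-K-sym tree-simple) ⟩
    incidenceWeight tree   ≡⟨ incidenceWeight-uniform 3 tree tree-edges ⟩
    3 * degreeSum tree     ≡⟨ cong (3 *_) tree-degreeSum ⟩
    42                     ∎
    where open ≡-Reasoning

  -- A spanning tree has 7 edges, each of weight at most 3.
  module _ {T : Graph k} (T-spanning : IsSpanningTreeCI E T) where

    private
      T-simple : IsSimple T
      T-simple = proj₁ (proj₁ T-spanning)

    spanning-degreeSum : degreeSum T ≤ 14
    spanning-degreeSum = ≤-trans (forest-degreeSum T T-simple (proj₂ (proj₂ (proj₁ T-spanning))))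
      (≤-reflexive (cong (λ m → 2 * (m ∸ 1)) k≡8))

    spanning-incidence : incidenceWeight T ≤ 3 * degreeSum T
    spanning-incidence = incidenceWeight≤ 3 shared-K≤3 T-simple

    spanning-weight : 2 * weight E T ≤ 42
    spanning-weight = begin
      2 * weight E T       ≡⟨ sym (incidenceWeight≡2*edgeWeight shared-K-sym T-simple) ⟩
      incidenceWeight T    ≤⟨ spanning-incidence ⟩
      3 * degreeSum T      ≤⟨ *-monoʳ-≤ 3 spanning-degreeSum ⟩
      42                   ∎
      where open ≤-Reasoning

  tree-cliqueTree : IsCliqueTree E tree
  tree-cliqueTree = tree-spanning ,
    λ T T-spanning →
      *-cancelˡ-≤ 2 (≤-trans (spanning-weight T-spanning) (≤-reflexive (sym tree-weight)))

  -- A clique tree T reaches weight 21, which forces every edge of T to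
  -- have weight 3 (so T ⊆ tree) and T to have 7 edges, like tree.
  cliqueTree-sameDegrees : ∀ {T} → IsCliqueTree E T → ∀ i → degree T i ≡ degree tree i
  cliqueTree-sameDegrees {T} (T-spanning , T-maximum) =
    subgraph-sameDegrees T⊆tree (≤-trans (≤-reflexive tree-degreeSum) 14≤degreeSum)
    where
    T-simple : IsSimple T
    T-simple = proj₁ (proj₁ T-spanning)
    42≤incidence : 42 ≤ incidenceWeight T
    42≤incidence = ≤-trans (≤-reflexive (sym tree-weight))
      (≤-trans (*-monoʳ-≤ 2 (T-maximum tree tree-spanning))
               (≤-reflexive (sym (incidenceWeight≡2*edgeWeight shared-K-sym T-simple))))
    T⊆tree : ∀ i j → Edge T i j → Edge tree i j
    T⊆tree i j e = shared≡3⇒edge (label i) (label j) (trans (sym (shared-K i j))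
      (incidenceWeight-tight 3 shared-K≤3 T-simple
        (≤-trans (*-monoʳ-≤ 3 (spanning-degreeSum T-spanning)) 42≤incidence) i j e))
    14≤degreeSum : 14 ≤ degreeSum T
    14≤degreeSum = *-cancelˡ-≤ 3 (≤-trans 42≤incidence (spanning-incidence T-spanning))

  cliqueTree-regular : ∀ T → IsCliqueTree E T → IsFourRegular T
  cliqueTree-regular T T-cliqueTree i 2≤deg = leaf-or-hub (ghTree-degrees (label i))
    where
    degree-T : degree T i ≡ degree ghTree (label i)
    degree-T = trans (cliqueTree-sameDegrees T-cliqueTree i) (degree-relabel relabelling ghTree i)
    2≰1 : ¬ 2 ≤ 1
    2≰1 (s≤s ())
    leaf-or-hub : degree ghTree (label i) ≡ 1 ⊎ degree ghTree (label i) ≡ 4 → degree T i ≡ 4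
    leaf-or-hub (inj₁ deg≡1) = ⊥-elim (2≰1 (subst (2 ≤_) (trans degree-T deg≡1) 2≤deg))
    leaf-or-hub (inj₂ deg≡4) = trans degree-T deg≡4

mainTheorem5 : InC1 goldnerHarary
mainTheorem5 =
  m≤m+n 6 5 ,
  gh-isRAN ,
  (GHCliques.enumeration , tree GHCliques.enumeration , tree-cliqueTree GHCliques.enumeration) ,
  cliqueTree-regular
  where open CliqueTreesOf
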